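{- Let $E=\{e_0,\dots,e_n\}\subset\mathbb R^n$ be the vertex set of a simplex with $e_0+\dots+e_n=0$, and let $X\subset\mathbb R^n\setminus\{0\}$ be a finite set with $E\subseteq X$, no element a positive multiple of another, such that no $n+1$ points of $X$ are in conical position. Then every $p=\sum_{e_i\in S_p}\lambda_ie_i$ in $X$ (normalized so that $\min_{e_i\in S_p}\lambda_i=1$) has $\lambda_i=1$ for all $e_i\in S_p$ except at most one index $j$ with $\lambda_j>1$.
   Context: For $p\in\mathbb R^n$, the support $S_p$ is the minimal subset of $E$ whose positive hull contains $p$; then $p=\sum_{e_i\in S_p}\lambda_ie_i$ with all $\lambda_i>0$. Elements of $X$ are normalized (by positive rescaling) so that $\min_{e_i\in S_p}\lambda_i=1$. A set of points is in conical position if $0$ is not in its convex hull and none of its points lies in the positive hull of the others. -}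

module Defs where

open import Level using (0ℓ)
open import Data.Nat using (ℕ; zero; suc)
open import Data.Fin using (Fin; zero; suc; punchIn)
open import Data.Fin.Subset using (Subset; _∈_; _∉_; _⊂_)
open import Data.Product using (Σ; ∃; _×_; _,_)
open import Data.Sum using (_⊎_)
open import Relation.Nullary using (¬_)
open import Relation.Binary.PropositionalEquality using (_≡_; _≢_)
open import Relation.Binary.Structures using (IsStrictTotalOrder)
open import Algebra.Structures using (IsCommutativeRing)

-- The real numbers, axiomatised as a complete ordered field
-- (equality is propositional equality).  Any model of this record is
-- (classically) isomorphic to ℝ.

record Reals : Set₁ where
  infixl 6 _+_
  infixl 7 _*_
  infix 4 _<_ _≤_
  field
    ℝ       : Set
    _+_ _*_ : ℝ → ℝ → ℝ
    -_      : ℝ → ℝ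
    0# 1#   : ℝ
    _⁻¹     : ℝ → ℝ
    _<_     : ℝ → ℝ → Set
    isCommutativeRing  : IsCommutativeRing _≡_ _+_ _*_ -_ 0# 1#
    ⁻¹-inverse         : ∀ x → x ≢ 0# → x * (x ⁻¹) ≡ 1#
    0≢1                : 0# ≢ 1#
    isStrictTotalOrder : IsStrictTotalOrder _≡_ _<_
    +-mono-<           : ∀ x y z → x < y → x + z < y + z
    *-pos              : ∀ x y → 0# < x → 0# < y → 0# < x * y

  _≤_ : ℝ → ℝ → Set
  x ≤ y = x < y ⊎ x ≡ y

  field
    completeness : (P : ℝ → Set) → ∃ P → (∃ λ b → ∀ x → P x → x ≤ b) →
                   ∃ λ s → (∀ x → P x → x ≤ s) ×
                           (∀ b → (∀ x → P x → x ≤ b) → s ≤ b)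

module Geometry (R : Reals) where
  open Reals R public

  Point : ℕ → Set
  Point n = Fin n → ℝ

  _≈_ : ∀ {n} → Point n → Point n → Set
  p ≈ q = ∀ k → p k ≡ q k

  0ᵥ : ∀ {n} → Point n
  0ᵥ _ = 0#

  _•_ : ∀ {n} → ℝ → Point n → Point n
  (c • p) k = c * p k

  sumℝ : ∀ {m} → (Fin m → ℝ) → ℝ
  sumℝ {zero}  f = 0#
  sumℝ {suc m} f = f zero + sumℝ (λ i → f (suc i))

  sumᵥ : ∀ {m n} → (Fin m → Point n) → Point n
  sumᵥ f k = sumℝ (λ i → f i k)

  lincomb : ∀ {m n} → (Fin m → ℝ) → (Fin m → Point n) → Point n
  lincomb μ q = sumᵥ (λ i → μ i • q i)

  InPosHull : ∀ {m n} → (Fin m → Point n) → Point n → Set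
  InPosHull q p = Σ (Fin _ → ℝ) λ μ → (∀ i → 0# ≤ μ i) × (p ≈ lincomb μ q)

  InConvHull : ∀ {m n} → (Fin m → Point n) → Point n → Set
  InConvHull q p = Σ (Fin _ → ℝ) λ μ →
    (∀ i → 0# ≤ μ i) × (sumℝ μ ≡ 1#) × (p ≈ lincomb μ q)

  ConicalPosition : ∀ {m n} → (Fin (suc m) → Point n) → Set
  ConicalPosition {m} q =
    ¬ InConvHull q 0ᵥ × (∀ j → ¬ InPosHull (λ (i : Fin m) → q (punchIn j i)) (q j))

  AffinelyIndependent : ∀ {m n} → (Fin m → Point n) → Set
  AffinelyIndependent q = ∀ μ → sumℝ μ ≡ 0# → lincomb μ q ≈ 0ᵥ → ∀ i → μ i ≡ 0#

  InPosHullOf : ∀ {m n} → (Fin m → Point n) → Subset m → Point n → Set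
  InPosHullOf e S p = Σ (Fin _ → ℝ) λ μ →
    (∀ i → 0# ≤ μ i) × (∀ i → i ∉ S → μ i ≡ 0#) × (p ≈ lincomb μ e)

  IsSupport : ∀ {m n} → (Fin m → Point n) → Subset m → Point n → Set
  IsSupport e S p = InPosHullOf e S p × (∀ T → T ⊂ S → ¬ InPosHullOf e T p)

{-# OPTIONS --safe #-}
module Submission where

-- Since e₀ + ⋯ + eₙ = 0 and the eᵢ are affinely independent, two coefficient vectors
-- give the same point exactly when they differ by a constant, so questions about
-- points built from the eᵢ become questions about coefficients.  If every vertex were
-- in S, subtracting 1 from all λᵢ would express p without e_{i₀} (where λ_{i₀} = 1),
-- against minimality of S; hence some λ_z = 0.  If moreover two coefficients exceeded 1,
-- then E with e_{i₀} replaced by p would be n + 1 distinct points of X in conical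
-- position, which is excluded.

open import Defs
open import Level using (0ℓ)
open import Algebra.Bundles using (CommutativeRing)
open import Relation.Binary.Structures using (IsStrictTotalOrder)
open import Relation.Binary.Definitions using (tri<; tri≈; tri>)
open import Relation.Binary.PropositionalEquality
open import Data.Nat using (ℕ; zero; suc)
open import Data.Fin using (Fin; zero; suc; punchIn; punchOut)
open import Data.Fin.Properties using (_≟_; punchInᵢ≢i; punchIn-punchOut; punchIn-injective; any?; ¬∀⟶∃¬)
open import Data.Fin.Subset using (Subset; _∈_; _∉_; ∁; ⁅_⁆)
open import Data.Fin.Subset.Properties using (_∈?_; x∈∁p⇒x∉p; x∉∁p⇒x∈p; x∈⁅x⁆; x∈⁅y⁆⇒x≡y)
open import Data.Sum using (inj₁; inj₂)
open import Data.Product using (Σ; ∃; _×_; _,_; proj₁; proj₂)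
open import Data.Empty using (⊥-elim)
open import Relation.Unary using (Pred; Decidable)
open import Relation.Nullary using (¬_; Dec; yes; no)
open import Relation.Nullary.Decidable using (¬?; _×-dec_; decidable-stable)
open import Function using (_∘_; id)
open import Function.Definitions using (Injective)

module OrderedField (R : Reals) where
  open Reals R

  commutativeRing : CommutativeRing 0ℓ 0ℓ
  commutativeRing = record { isCommutativeRing = isCommutativeRing }

  open CommutativeRing commutativeRing public
    using ( +-assoc; +-comm; +-identityˡ; +-identityʳ; -‿inverseˡ; -‿inverseʳ
          ; *-assoc; *-comm; *-identityˡ; *-identityʳ; zeroˡ; zeroʳ; distribˡ; distribʳ
          ; semiring; ring)
  open import Algebra.Properties.Ring ring public
    using (-‿distribˡ-*; -‿distribʳ-*; -‿involutive; -‿+-comm; -0#≈0#; x∙y⁻¹≈ε⇒x≈y)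
  open IsStrictTotalOrder isStrictTotalOrder public
    using (compare) renaming (_≟_ to _≟ℝ_; trans to <-trans)

  <-irrefl : ∀ {x} → ¬ x < x
  <-irrefl = IsStrictTotalOrder.irrefl isStrictTotalOrder refl

  ≤-trans : ∀ {x y z} → x ≤ y → y ≤ z → x ≤ z
  ≤-trans (inj₁ x<y) (inj₁ y<z) = inj₁ (<-trans x<y y<z)
  ≤-trans x≤y        (inj₂ refl) = x≤y
  ≤-trans (inj₂ refl) y≤z        = y≤z

  <-≤-trans : ∀ {x y z} → x < y → y ≤ z → x < z
  <-≤-trans x<y (inj₁ y<z)  = <-trans x<y y<z
  <-≤-trans x<y (inj₂ refl) = x<y

  ≤∧≢⇒< : ∀ {x y} → x ≤ y → x ≢ y → x < y
  ≤∧≢⇒< (inj₁ x<y) _   = x<y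
  ≤∧≢⇒< (inj₂ x≡y) x≢y = ⊥-elim (x≢y x≡y)

  ≤-antisym : ∀ {x y} → x ≤ y → y ≤ x → x ≡ y
  ≤-antisym (inj₂ x≡y) _          = x≡y
  ≤-antisym (inj₁ x<y) (inj₂ y≡x) = sym y≡x
  ≤-antisym (inj₁ x<y) (inj₁ y<x) = ⊥-elim (<-irrefl (<-trans x<y y<x))

  +-monoʳ-< : ∀ x {y z} → y < z → x + y < x + z
  +-monoʳ-< x {y} {z} y<z = subst₂ _<_ (+-comm y x) (+-comm z x) (+-mono-< y z x y<z)

  x≤x+y : ∀ x {y} → 0# ≤ y → x ≤ x + y
  x≤x+y x (inj₁ 0<y)  = inj₁ (subst (_< x + _) (+-identityʳ x) (+-monoʳ-< x 0<y))
  x≤x+y x (inj₂ refl) = inj₂ (sym (+-identityʳ x))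

  <⇒0<- : ∀ {x y} → x < y → 0# < y + - x
  <⇒0<- {x} {y} x<y = subst (_< y + - x) (-‿inverseʳ x) (+-mono-< x y (- x) x<y)

  ≤⇒0≤- : ∀ {x y} → x ≤ y → 0# ≤ y + - x
  ≤⇒0≤- (inj₁ x<y)       = inj₁ (<⇒0<- x<y)
  ≤⇒0≤- {x} (inj₂ refl) = inj₂ (sym (-‿inverseʳ x))

  -- if 1 < 0 then 0 < -1, hence 0 < (-1) * (-1) = 1
  0<1 : 0# < 1#
  0<1 with compare 0# 1#
  ... | tri< 0<1 _ _ = 0<1
  ... | tri≈ _ 0≡1 _ = ⊥-elim (0≢1 0≡1)
  ... | tri> _ _ 1<0 = ⊥-elim (<-irrefl (<-trans 1<0 0<[-1]*[-1]))
    where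
    0<-1 : 0# < - 1#
    0<-1 = subst (0# <_) (+-identityˡ (- 1#)) (<⇒0<- 1<0)
    [-1]*[-1]≡1 : - 1# * - 1# ≡ 1#
    [-1]*[-1]≡1 = begin
      - 1# * - 1#    ≡⟨ -‿distribˡ-* 1# (- 1#) ⟨
      - (1# * - 1#)  ≡⟨ cong -_ (*-identityˡ (- 1#)) ⟩
      - - 1#         ≡⟨ -‿involutive 1# ⟩
      1#             ∎
      where open ≡-Reasoning
    0<[-1]*[-1] : 0# < 1#
    0<[-1]*[-1] = subst (0# <_) [-1]*[-1]≡1 (*-pos _ _ 0<-1 0<-1)

  0≤1 : 0# ≤ 1#
  0≤1 = inj₁ 0<1

  0<1+x : ∀ {x} → 0# ≤ x → 0# < 1# + x
  0<1+x 0≤x = <-≤-trans 0<1 (x≤x+y 1# 0≤x)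

  *-nonneg : ∀ {x y} → 0# ≤ x → 0# ≤ y → 0# ≤ x * y
  *-nonneg (inj₁ 0<x)  (inj₁ 0<y)  = inj₁ (*-pos _ _ 0<x 0<y)
  *-nonneg (inj₂ refl) _           = inj₂ (sym (zeroˡ _))
  *-nonneg _           (inj₂ refl) = inj₂ (sym (zeroʳ _))

  x<x*y : ∀ {x y} → 0# < x → 1# < y → x < x * y
  x<x*y {x} {y} 0<x 1<y =
    subst₂ _<_ (+-identityˡ x) x[y-1]+x≡xy (+-mono-< 0# _ x (*-pos _ _ 0<x (<⇒0<- 1<y)))
    where
    open ≡-Reasoning
    x[y-1]+x≡xy : x * (y + - 1#) + x ≡ x * y
    x[y-1]+x≡xy = begin
      x * (y + - 1#) + x          ≡⟨ cong (_+ x) (distribˡ x y (- 1#)) ⟩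
      x * y + x * - 1# + x        ≡⟨ cong (λ t → x * y + t + x) (-‿distribʳ-* x 1#) ⟨
      x * y + - (x * 1#) + x      ≡⟨ cong (λ t → x * y + - t + x) (*-identityʳ x) ⟩
      x * y + - x + x             ≡⟨ +-assoc (x * y) (- x) x ⟩
      x * y + (- x + x)           ≡⟨ cong (x * y +_) (-‿inverseˡ x) ⟩
      x * y + 0#                  ≡⟨ +-identityʳ (x * y) ⟩
      x * y                       ∎

  x*y≤x⇒x≡0 : ∀ {x y} → 0# ≤ x → 1# < y → x * y ≤ x → x ≡ 0#
  x*y≤x⇒x≡0 (inj₁ 0<x)  1<y xy≤x = ⊥-elim (<-irrefl (<-≤-trans (x<x*y 0<x 1<y) xy≤x))
  x*y≤x⇒x≡0 (inj₂ 0≡x)  _   _    = sym 0≡x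

  x-y+[y+z]≡x+z : ∀ x y z → x + - y + (y + z) ≡ x + z
  x-y+[y+z]≡x+z x y z = begin
    x + - y + (y + z)    ≡⟨ +-assoc x (- y) (y + z) ⟩
    x + (- y + (y + z))  ≡⟨ cong (x +_) (+-assoc (- y) y z) ⟨
    x + (- y + y + z)    ≡⟨ cong (λ t → x + (t + z)) (-‿inverseˡ y) ⟩
    x + (0# + z)         ≡⟨ cong (x +_) (+-identityˡ z) ⟩
    x + z                ∎
    where open ≡-Reasoning

module Sums (R : Reals) where
  open Geometry R
  open OrderedField R
  open import Algebra.Properties.Semiring.Sum semiring
    using (sum; sum-cong-≗; ∑-distrib-+; ∑-comm; sum-remove; *-distribˡ-sum; *-distribʳ-sum)
  open ≡-Reasoning

  sumℝ≡sum : ∀ {m} (f : Fin m → ℝ) → sumℝ f ≡ sum f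
  sumℝ≡sum {zero}  f = refl
  sumℝ≡sum {suc m} f = cong (f zero +_) (sumℝ≡sum (f ∘ suc))

  sumℝ-cong : ∀ {m} {f g : Fin m → ℝ} → (∀ i → f i ≡ g i) → sumℝ f ≡ sumℝ g
  sumℝ-cong {f = f} {g} f≗g = begin
    sumℝ f  ≡⟨ sumℝ≡sum f ⟩
    sum f   ≡⟨ sum-cong-≗ f≗g ⟩
    sum g   ≡⟨ sumℝ≡sum g ⟨
    sumℝ g  ∎

  sumℝ-+ : ∀ {m} (f g : Fin m → ℝ) → sumℝ (λ i → f i + g i) ≡ sumℝ f + sumℝ g
  sumℝ-+ f g = begin
    sumℝ (λ i → f i + g i)  ≡⟨ sumℝ≡sum (λ i → f i + g i) ⟩
    sum (λ i → f i + g i)   ≡⟨ ∑-distrib-+ f g ⟩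
    sum f + sum g           ≡⟨ cong₂ _+_ (sumℝ≡sum f) (sumℝ≡sum g) ⟨
    sumℝ f + sumℝ g         ∎

  *-distribˡ-sumℝ : ∀ {m} x (f : Fin m → ℝ) → x * sumℝ f ≡ sumℝ (λ i → x * f i)
  *-distribˡ-sumℝ x f = begin
    x * sumℝ f             ≡⟨ cong (x *_) (sumℝ≡sum f) ⟩
    x * sum f              ≡⟨ *-distribˡ-sum x f ⟩
    sum (λ i → x * f i)    ≡⟨ sumℝ≡sum (λ i → x * f i) ⟨
    sumℝ (λ i → x * f i)   ∎

  *-distribʳ-sumℝ : ∀ {m} x (f : Fin m → ℝ) → sumℝ f * x ≡ sumℝ (λ i → f i * x)
  *-distribʳ-sumℝ x f = begin
    sumℝ f * x             ≡⟨ cong (_* x) (sumℝ≡sum f) ⟩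
    sum f * x              ≡⟨ *-distribʳ-sum x f ⟩
    sum (λ i → f i * x)    ≡⟨ sumℝ≡sum (λ i → f i * x) ⟨
    sumℝ (λ i → f i * x)   ∎

  sumℝ-comm : ∀ {l m} (f : Fin l → Fin m → ℝ) →
              sumℝ (λ a → sumℝ (f a)) ≡ sumℝ (λ i → sumℝ (λ a → f a i))
  sumℝ-comm f = begin
    sumℝ (λ a → sumℝ (f a))          ≡⟨ sumℝ-cong (λ a → sumℝ≡sum (f a)) ⟩
    sumℝ (λ a → sum (f a))           ≡⟨ sumℝ≡sum (λ a → sum (f a)) ⟩
    sum (λ a → sum (f a))            ≡⟨ ∑-comm f ⟩
    sum (λ i → sum (λ a → f a i))    ≡⟨ sumℝ≡sum (λ i → sum (λ a → f a i)) ⟨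
    sumℝ (λ i → sum (λ a → f a i))   ≡⟨ sumℝ-cong (λ i → sumℝ≡sum (λ a → f a i)) ⟨
    sumℝ (λ i → sumℝ (λ a → f a i))  ∎

  sumℝ-remove : ∀ {m} (f : Fin (suc m) → ℝ) j → sumℝ f ≡ f j + sumℝ (f ∘ punchIn j)
  sumℝ-remove f j = begin
    sumℝ f                      ≡⟨ sumℝ≡sum f ⟩
    sum f                       ≡⟨ sum-remove f ⟩
    f j + sum (f ∘ punchIn j)   ≡⟨ cong (f j +_) (sumℝ≡sum (f ∘ punchIn j)) ⟨
    f j + sumℝ (f ∘ punchIn j)  ∎

  sumℝ-neg : ∀ {m} (f : Fin m → ℝ) → sumℝ (λ i → - f i) ≡ - sumℝ f
  sumℝ-neg {zero}  f = sym -0#≈0#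
  sumℝ-neg {suc m} f = trans (cong (- f zero +_) (sumℝ-neg (f ∘ suc))) (-‿+-comm (f zero) _)

  sumℝ-zero : ∀ {m} {f : Fin m → ℝ} → (∀ i → f i ≡ 0#) → sumℝ f ≡ 0#
  sumℝ-zero {zero}  f≗0 = refl
  sumℝ-zero {suc m} f≗0 = trans (cong₂ _+_ (f≗0 zero) (sumℝ-zero (f≗0 ∘ suc))) (+-identityʳ 0#)

  sumℝ-single : ∀ {m} {f : Fin m → ℝ} j → (∀ i → i ≢ j → f i ≡ 0#) → sumℝ f ≡ f j
  sumℝ-single {suc m} {f} j off = begin
    sumℝ f                      ≡⟨ sumℝ-remove f j ⟩
    f j + sumℝ (f ∘ punchIn j)  ≡⟨ cong (f j +_) (sumℝ-zero (λ i → off (punchIn j i) (punchInᵢ≢i j i))) ⟩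
    f j + 0#                    ≡⟨ +-identityʳ (f j) ⟩
    f j                         ∎

  sumℝ-nonneg : ∀ {m} {f : Fin m → ℝ} → (∀ i → 0# ≤ f i) → 0# ≤ sumℝ f
  sumℝ-nonneg {zero}  _     = inj₂ refl
  sumℝ-nonneg {suc m} 0≤f = ≤-trans (0≤f zero) (x≤x+y _ (sumℝ-nonneg (0≤f ∘ suc)))

  ≤-sumℝ : ∀ {m} {f : Fin m → ℝ} → (∀ i → 0# ≤ f i) → ∀ j → f j ≤ sumℝ f
  ≤-sumℝ {suc m} {f} 0≤f j =
    subst (f j ≤_) (sym (sumℝ-remove f j)) (x≤x+y (f j) (sumℝ-nonneg (0≤f ∘ punchIn j)))

module LinearCombinations (R : Reals) where
  open Geometry R
  open OrderedField R
  open Sums R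
  open ≡-Reasoning

  basis : ∀ {m} → Fin m → Fin m → ℝ
  basis j i with i ≟ j
  ... | yes _ = 1#
  ... | no  _ = 0#

  basis-diag : ∀ {m} (j : Fin m) → basis j j ≡ 1#
  basis-diag j with j ≟ j
  ... | yes _   = refl
  ... | no  j≢j = ⊥-elim (j≢j refl)

  basis-off : ∀ {m} {i j : Fin m} → i ≢ j → basis j i ≡ 0#
  basis-off {i = i} {j} i≢j with i ≟ j
  ... | yes i≡j = ⊥-elim (i≢j i≡j)
  ... | no  _   = refl

  basis-nonneg : ∀ {m} (j i : Fin m) → 0# ≤ basis j i
  basis-nonneg j i with i ≟ j
  ... | yes _ = 0≤1
  ... | no  _ = inj₂ refl

  lincomb-basis : ∀ {m n} (q : Fin m → Point n) j → lincomb (basis j) q ≈ q j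
  lincomb-basis {suc m} q j k = begin
    lincomb (basis j) q k  ≡⟨ sumℝ-single j (λ i i≢j → trans (cong (_* q i k) (basis-off i≢j)) (zeroˡ (q i k))) ⟩
    basis j j * q j k      ≡⟨ cong (_* q j k) (basis-diag j) ⟩
    1# * q j k             ≡⟨ *-identityˡ (q j k) ⟩
    q j k                  ∎

  lincomb-+const : ∀ {m n} (q : Fin m → Point n) → sumᵥ q ≈ 0ᵥ →
                   ∀ μ c → lincomb (λ i → μ i + c) q ≈ lincomb μ q
  lincomb-+const q Σq≈0 μ c k = begin
    sumℝ (λ i → (μ i + c) * q i k)            ≡⟨ sumℝ-cong (λ i → distribʳ (q i k) (μ i) c) ⟩
    sumℝ (λ i → μ i * q i k + c * q i k)      ≡⟨ sumℝ-+ (λ i → μ i * q i k) (λ i → c * q i k) ⟩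
    lincomb μ q k + sumℝ (λ i → c * q i k)    ≡⟨ cong (lincomb μ q k +_) (*-distribˡ-sumℝ c (λ i → q i k)) ⟨
    lincomb μ q k + c * sumᵥ q k              ≡⟨ cong (λ t → lincomb μ q k + c * t) (Σq≈0 k) ⟩
    lincomb μ q k + c * 0#                    ≡⟨ cong (lincomb μ q k +_) (zeroʳ c) ⟩
    lincomb μ q k + 0#                        ≡⟨ +-identityʳ _ ⟩
    lincomb μ q k                             ∎

  lincomb-- : ∀ {m n} (q : Fin m → Point n) μ ν k →
              lincomb (λ i → μ i + - ν i) q k ≡ lincomb μ q k + - lincomb ν q k
  lincomb-- q μ ν k = begin
    sumℝ (λ i → (μ i + - ν i) * q i k)              ≡⟨ sumℝ-cong (λ i → distribʳ (q i k) (μ i) (- ν i)) ⟩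
    sumℝ (λ i → μ i * q i k + - ν i * q i k)        ≡⟨ sumℝ-+ (λ i → μ i * q i k) (λ i → - ν i * q i k) ⟩
    lincomb μ q k + sumℝ (λ i → - ν i * q i k)      ≡⟨ cong (lincomb μ q k +_) (sumℝ-cong (λ i → -‿distribˡ-* (ν i) (q i k))) ⟨
    lincomb μ q k + sumℝ (λ i → - (ν i * q i k))    ≡⟨ cong (lincomb μ q k +_) (sumℝ-neg (λ i → ν i * q i k)) ⟩
    lincomb μ q k + - lincomb ν q k                 ∎

  -- a coefficient vector is itself a point, so lincomb μ c is the coefficient vector of lincomb μ q
  lincomb-lincomb : ∀ {l m n} (q : Fin l → Point n) (c : Fin l → Point m) (e : Fin m → Point n) →
                    (∀ a → q a ≈ lincomb (c a) e) → ∀ μ → lincomb μ q ≈ lincomb (lincomb μ c) e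
  lincomb-lincomb q c e q≈ce μ k = begin
    sumℝ (λ a → μ a * q a k)                        ≡⟨ sumℝ-cong (λ a → cong (μ a *_) (q≈ce a k)) ⟩
    sumℝ (λ a → μ a * lincomb (c a) e k)            ≡⟨ sumℝ-cong (λ a → *-distribˡ-sumℝ (μ a) (λ i → c a i * e i k)) ⟩
    sumℝ (λ a → sumℝ (λ i → μ a * (c a i * e i k))) ≡⟨ sumℝ-cong (λ a → sumℝ-cong (λ i → *-assoc (μ a) (c a i) (e i k))) ⟨
    sumℝ (λ a → sumℝ (λ i → μ a * c a i * e i k))   ≡⟨ sumℝ-comm (λ a i → μ a * c a i * e i k) ⟩
    sumℝ (λ i → sumℝ (λ a → μ a * c a i * e i k))   ≡⟨ sumℝ-cong (λ i → *-distribʳ-sumℝ (e i k) (λ a → μ a * c a i)) ⟨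
    sumℝ (λ i → lincomb μ c i * e i k)              ∎

module _ (R : Reals) where
  open Geometry R
  open OrderedField R
  open Sums R
  open LinearCombinations R
  open ≡-Reasoning

  module Simplex {n} (e : Fin (suc n) → Point n) (independent : AffinelyIndependent e)
                 (Σe≈0 : sumᵥ e ≈ 0ᵥ) where

    lincomb≈0⇒constant : ∀ D → lincomb D e ≈ 0ᵥ → ∀ i j → D i ≡ D j
    lincomb≈0⇒constant D De≈0 i j = trans (D≡mean i) (sym (D≡mean j))
      where
      N : ℝ
      N = sumℝ (λ (_ : Fin (suc n)) → 1#)

      N≢0 : N ≢ 0#
      N≢0 N≡0 = <-irrefl (subst (0# <_) N≡0 (0<1+x (sumℝ-nonneg {n} (λ _ → 0≤1))))

      mean : ℝ
      mean = sumℝ D * N ⁻¹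

      mean*N≡ΣD : mean * N ≡ sumℝ D
      mean*N≡ΣD = begin
        sumℝ D * N ⁻¹ * N    ≡⟨ *-assoc (sumℝ D) (N ⁻¹) N ⟩
        sumℝ D * (N ⁻¹ * N)  ≡⟨ cong (sumℝ D *_) (trans (*-comm (N ⁻¹) N) (⁻¹-inverse N N≢0)) ⟩
        sumℝ D * 1#          ≡⟨ *-identityʳ (sumℝ D) ⟩
        sumℝ D               ∎

      Σ[D-mean]≡0 : sumℝ (λ i → D i + - mean) ≡ 0#
      Σ[D-mean]≡0 = begin
        sumℝ (λ i → D i + - mean)                      ≡⟨ sumℝ-+ D (λ _ → - mean) ⟩
        sumℝ D + sumℝ (λ (_ : Fin (suc n)) → - mean)   ≡⟨ cong (sumℝ D +_) (sumℝ-cong {suc n} (λ _ → *-identityʳ (- mean))) ⟨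
        sumℝ D + sumℝ {suc n} (λ _ → - mean * 1#)      ≡⟨ cong (sumℝ D +_) (*-distribˡ-sumℝ {suc n} (- mean) (λ _ → 1#)) ⟨
        sumℝ D + - mean * N                            ≡⟨ cong (sumℝ D +_) (-‿distribˡ-* mean N) ⟨
        sumℝ D + - (mean * N)                          ≡⟨ cong (λ t → sumℝ D + - t) mean*N≡ΣD ⟩
        sumℝ D + - sumℝ D                              ≡⟨ -‿inverseʳ (sumℝ D) ⟩
        0#                                             ∎

      D≡mean : ∀ i → D i ≡ mean
      D≡mean i = x∙y⁻¹≈ε⇒x≈y (D i) mean
        (independent (λ i → D i + - mean) Σ[D-mean]≡0
          (λ k → trans (lincomb-+const e Σe≈0 D (- mean) k) (De≈0 k)) i)

    lincomb≈⇒constant-difference : ∀ A B → lincomb A e ≈ lincomb B e → ∀ i j → A i + B j ≡ A j + B i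
    lincomb≈⇒constant-difference A B Ae≈Be i j = begin
      A i + B j                  ≡⟨ x-y+[y+z]≡x+z (A i) (B i) (B j) ⟨
      A i + - B i + (B i + B j)  ≡⟨ cong₂ _+_ (A-B-constant i j) (+-comm (B i) (B j)) ⟩
      A j + - B j + (B j + B i)  ≡⟨ x-y+[y+z]≡x+z (A j) (B j) (B i) ⟩
      A j + B i                  ∎
      where
      A-B-constant : ∀ i j → A i + - B i ≡ A j + - B j
      A-B-constant = lincomb≈0⇒constant (λ i → A i + - B i) λ k →
        trans (lincomb-- e A B k) (trans (cong (_+ - lincomb B e k) (Ae≈Be k)) (-‿inverseʳ _))

    ¬full-support : ∀ {S p λ′} i₀ → IsSupport e S p → p ≈ lincomb λ′ e →
                    (∀ i → i ∈ S → 1# ≤ λ′ i) → λ′ i₀ ≡ 1# → ¬ (∀ i → i ∈ S)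
    ¬full-support {p = p} {λ′} i₀ (_ , minimal) p≈λe 1≤λ λi₀≡1 full =
      minimal (∁ ⁅ i₀ ⁆) ((λ {i} _ → full i) , i₀ , full i₀ , i₀∉T) (μ , μ≥0 , μ-outside , p≈μe)
      where
      i₀∉T : i₀ ∉ ∁ ⁅ i₀ ⁆
      i₀∉T i₀∈T = x∈∁p⇒x∉p i₀∈T (x∈⁅x⁆ i₀)

      μ : Fin (suc n) → ℝ
      μ i = λ′ i + - 1#

      μ≥0 : ∀ i → 0# ≤ μ i
      μ≥0 i = ≤⇒0≤- (1≤λ i (full i))

      μ-outside : ∀ i → i ∉ ∁ ⁅ i₀ ⁆ → μ i ≡ 0#
      μ-outside i i∉T = begin
        λ′ i + - 1#   ≡⟨ cong (λ j → λ′ j + - 1#) (x∈⁅y⁆⇒x≡y i₀ (x∉∁p⇒x∈p i∉T)) ⟩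
        λ′ i₀ + - 1#  ≡⟨ cong (_+ - 1#) λi₀≡1 ⟩
        1# + - 1#     ≡⟨ -‿inverseʳ 1# ⟩
        0#            ∎

      p≈μe : p ≈ lincomb μ e
      p≈μe k = trans (p≈λe k) (sym (lincomb-+const e Σe≈0 λ′ (- 1#) k))

  support-nonneg : ∀ {m} {S : Subset m} {λ′ : Fin m → ℝ} →
                   (∀ i → i ∈ S → 0# < λ′ i) → (∀ i → i ∉ S → λ′ i ≡ 0#) → ∀ i → 0# ≤ λ′ i
  support-nonneg {S = S} λ>0 λ≡0 i with i ∈? S
  ... | yes i∈S = inj₁ (λ>0 i i∈S)
  ... | no  i∉S = inj₂ (sym (λ≡0 i i∉S))

  -- a repeated point would lie in the positive hull of the others
  conical⇒injective : ∀ {A : Set} {l n} (x : A → Point n) (σ : Fin (suc l) → A) →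
                      ConicalPosition (λ i → x (σ i)) → Injective _≡_ _≡_ σ
  conical⇒injective x σ (_ , notInPosHull) {a} {b} σa≡σb with a ≟ b
  ... | yes a≡b = a≡b
  ... | no  a≢b = ⊥-elim (notInPosHull a (basis b′ , basis-nonneg b′ , xσa≈))
    where
    b′ = punchOut a≢b
    xσa≈ : x (σ a) ≈ lincomb (basis b′) (λ i → x (σ (punchIn a i)))
    xσa≈ k = begin
      x (σ a) k                                         ≡⟨ cong (λ c → x c k) σa≡σb ⟩
      x (σ b) k                                         ≡⟨ cong (λ c → x (σ c) k) (punchIn-punchOut a≢b) ⟨
      x (σ (punchIn a b′)) k                            ≡⟨ lincomb-basis (λ i → x (σ (punchIn a i))) b′ k ⟨
      lincomb (basis b′) (λ i → x (σ (punchIn a i))) k  ∎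

  -- q is the family E with the vertex e i₀ replaced by p = x k, and coords a is the
  -- coefficient vector of q a with respect to e
  module Exchange {n} (e : Fin (suc n) → Point n) (independent : AffinelyIndependent e)
                  (Σe≈0 : sumᵥ e ≈ 0ᵥ) {m} (x : Fin m → Point n)
                  (vertex : ∀ i → ∃ λ k → x k ≈ e i) (k : Fin m) (λ′ : Fin (suc n) → ℝ)
                  (xk≈λe : x k ≈ lincomb λ′ e) (λ≥0 : ∀ i → 0# ≤ λ′ i)
                  (i₀ : Fin (suc n)) (λi₀≡1 : λ′ i₀ ≡ 1#) where
    open Simplex e independent Σe≈0

    σ : Fin (suc n) → Fin m
    σ a with a ≟ i₀
    ... | yes _ = k
    ... | no  _ = proj₁ (vertex a)

    q : Fin (suc n) → Point n
    q a = x (σ a)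

    coords : Fin (suc n) → Point (suc n)
    coords a with a ≟ i₀
    ... | yes _ = λ′
    ... | no  _ = basis a

    q≈coords·e : ∀ a → q a ≈ lincomb (coords a) e
    q≈coords·e a with a ≟ i₀
    ... | yes _ = xk≈λe
    ... | no  _ = λ k′ → trans (proj₂ (vertex a) k′) (sym (lincomb-basis e a k′))

    coords-i₀ : coords i₀ ≡ λ′
    coords-i₀ with i₀ ≟ i₀
    ... | yes _     = refl
    ... | no  i₀≢i₀ = ⊥-elim (i₀≢i₀ refl)

    coords-diag : ∀ a → coords a a ≡ 1#
    coords-diag a with a ≟ i₀
    ... | yes refl = λi₀≡1
    ... | no  _    = basis-diag a

    coords-off : ∀ {a i} → a ≢ i₀ → a ≢ i → coords a i ≡ 0#
    coords-off {a} a≢i₀ a≢i with a ≟ i₀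
    ... | yes a≡i₀ = ⊥-elim (a≢i₀ a≡i₀)
    ... | no  _    = basis-off (a≢i ∘ sym)

    coords-nonneg : ∀ a i → 0# ≤ coords a i
    coords-nonneg a i with a ≟ i₀
    ... | yes _ = λ≥0 i
    ... | no  _ = basis-nonneg a i

    module _ {l} (ν : Fin l → ℝ) (f : Fin l → Fin (suc n)) where

      lincomb-coords-nonneg : (∀ b → 0# ≤ ν b) → ∀ i → 0# ≤ lincomb ν (coords ∘ f) i
      lincomb-coords-nonneg ν≥0 i = sumℝ-nonneg (λ b → *-nonneg (ν≥0 b) (coords-nonneg (f b) i))

      ≤-lincomb-coords : (∀ b → 0# ≤ ν b) → ∀ b i → ν b * coords (f b) i ≤ lincomb ν (coords ∘ f) i
      ≤-lincomb-coords ν≥0 b i = ≤-sumℝ (λ b′ → *-nonneg (ν≥0 b′) (coords-nonneg (f b′) i)) b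

      lincomb-coords-single : ∀ b i → f b ≡ i₀ → (∀ b′ → b′ ≢ b → f b′ ≢ i₀ × f b′ ≢ i) →
                              lincomb ν (coords ∘ f) i ≡ ν b * λ′ i
      lincomb-coords-single b i fb≡i₀ others = begin
        lincomb ν (coords ∘ f) i  ≡⟨ sumℝ-single b other-terms-vanish ⟩
        ν b * coords (f b) i      ≡⟨ cong (λ a → ν b * coords a i) fb≡i₀ ⟩
        ν b * coords i₀ i         ≡⟨ cong (λ c → ν b * c i) coords-i₀ ⟩
        ν b * λ′ i                ∎
        where
        other-terms-vanish : ∀ b′ → b′ ≢ b → ν b′ * coords (f b′) i ≡ 0#
        other-terms-vanish b′ b′≢b with others b′ b′≢b
        ... | fb′≢i₀ , fb′≢i = trans (cong (ν b′ *_) (coords-off fb′≢i₀ fb′≢i)) (zeroʳ (ν b′))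

    0∉convHull : ∀ {j} → 1# < λ′ j → ¬ InConvHull q 0ᵥ
    0∉convHull {j} 1<λj (μ , μ≥0 , Σμ≡1 , 0≈μq) = 0≢1 (trans (sym (sumℝ-zero μ≡0)) Σμ≡1)
      where
      A : Point (suc n)
      A = lincomb μ coords

      A-constant : ∀ i i′ → A i ≡ A i′
      A-constant = lincomb≈0⇒constant A λ k′ →
        trans (sym (lincomb-lincomb q coords e q≈coords·e μ k′)) (sym (0≈μq k′))

      Ai₀≡μi₀ : A i₀ ≡ μ i₀
      Ai₀≡μi₀ = begin
        A i₀          ≡⟨ lincomb-coords-single μ id i₀ i₀ refl (λ b b≢i₀ → b≢i₀ , b≢i₀) ⟩
        μ i₀ * λ′ i₀  ≡⟨ cong (μ i₀ *_) λi₀≡1 ⟩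
        μ i₀ * 1#     ≡⟨ *-identityʳ (μ i₀) ⟩
        μ i₀          ∎

      μi₀≡0 : μ i₀ ≡ 0#
      μi₀≡0 = x*y≤x⇒x≡0 (μ≥0 i₀) 1<λj
        (subst₂ _≤_ (cong (λ c → μ i₀ * c j) coords-i₀) (trans (A-constant j i₀) Ai₀≡μi₀)
          (≤-lincomb-coords μ id μ≥0 i₀ j))

      μ≡0 : ∀ a → μ a ≡ 0#
      μ≡0 a = ≤-antisym
        (subst₂ _≤_ (trans (cong (μ a *_) (coords-diag a)) (*-identityʳ (μ a)))
                    (trans (A-constant a i₀) (trans Ai₀≡μi₀ μi₀≡0))
                    (≤-lincomb-coords μ id μ≥0 a a))
        (μ≥0 a)

    posHull⇒cross : ∀ jj ν → q jj ≈ lincomb ν (q ∘ punchIn jj) → ∀ i i′ →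
                    coords jj i + lincomb ν (coords ∘ punchIn jj) i′ ≡
                    coords jj i′ + lincomb ν (coords ∘ punchIn jj) i
    posHull⇒cross jj ν qjj≈νq = lincomb≈⇒constant-difference (coords jj) (lincomb ν (coords ∘ punchIn jj))
      λ k′ → trans (sym (q≈coords·e jj k′)) (trans (qjj≈νq k′)
               (lincomb-lincomb (q ∘ punchIn jj) (coords ∘ punchIn jj) e (q≈coords·e ∘ punchIn jj) ν k′))

    -- the witness z with λ′ z = 0 is what rules out p from the cone over the other vertices
    q-i₀∉posHull : ∀ {z} → λ′ z ≡ 0# → ¬ InPosHull (q ∘ punchIn i₀) (q i₀)
    q-i₀∉posHull {z} λz≡0 (ν , ν≥0 , qi₀≈νq) =
      <-irrefl (subst (0# <_) 1+Bz≡0 (0<1+x (lincomb-coords-nonneg ν (punchIn i₀) ν≥0 z)))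
      where
      B : Point (suc n)
      B = lincomb ν (coords ∘ punchIn i₀)

      Bi₀≡0 : B i₀ ≡ 0#
      Bi₀≡0 = sumℝ-zero λ b →
        trans (cong (ν b *_) (coords-off (punchInᵢ≢i i₀ b) (punchInᵢ≢i i₀ b))) (zeroʳ (ν b))

      1+Bz≡0 : 1# + B z ≡ 0#
      1+Bz≡0 = begin
        1# + B z            ≡⟨ cong (_+ B z) (coords-diag i₀) ⟨
        coords i₀ i₀ + B z  ≡⟨ posHull⇒cross i₀ ν qi₀≈νq i₀ z ⟩
        coords i₀ z + B i₀  ≡⟨ cong₂ _+_ (trans (cong (λ c → c z) coords-i₀) λz≡0) Bi₀≡0 ⟩
        0# + 0#             ≡⟨ +-identityʳ 0# ⟩
        0#                  ∎

    -- a second large coefficient λ′ b (b ≠ jj) forces the weight t of p to vanish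
    q-off-i₀∉posHull : ∀ {jj b} → jj ≢ i₀ → b ≢ jj → 1# < λ′ b → ¬ InPosHull (q ∘ punchIn jj) (q jj)
    q-off-i₀∉posHull {jj} {b} jj≢i₀ b≢jj 1<λb (ν , ν≥0 , qjj≈νq) = 0≢1 (sym 1≡0)
      where
      B : Point (suc n)
      B = lincomb ν (coords ∘ punchIn jj)

      b₀ : Fin n
      b₀ = punchOut jj≢i₀

      t : ℝ
      t = ν b₀

      punchIn-b₀ : punchIn jj b₀ ≡ i₀
      punchIn-b₀ = punchIn-punchOut jj≢i₀

      punchIn≢i₀ : ∀ b′ → b′ ≢ b₀ → punchIn jj b′ ≢ i₀
      punchIn≢i₀ b′ b′≢b₀ eq = b′≢b₀ (punchIn-injective jj b′ b₀ (trans eq (sym punchIn-b₀)))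

      coords-jj : ∀ {i} → i ≢ jj → coords jj i ≡ 0#
      coords-jj i≢jj = coords-off jj≢i₀ (i≢jj ∘ sym)

      Bi₀≡t : B i₀ ≡ t
      Bi₀≡t = begin
        B i₀       ≡⟨ lincomb-coords-single ν (punchIn jj) b₀ i₀ punchIn-b₀
                        (λ b′ b′≢b₀ → punchIn≢i₀ b′ b′≢b₀ , punchIn≢i₀ b′ b′≢b₀) ⟩
        t * λ′ i₀  ≡⟨ cong (t *_) λi₀≡1 ⟩
        t * 1#     ≡⟨ *-identityʳ t ⟩
        t          ∎

      Bjj≡tλjj : B jj ≡ t * λ′ jj
      Bjj≡tλjj = lincomb-coords-single ν (punchIn jj) b₀ jj punchIn-b₀
                   (λ b′ b′≢b₀ → punchIn≢i₀ b′ b′≢b₀ , punchInᵢ≢i jj b′)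

      Bb≡t : B b ≡ t
      Bb≡t = begin
        B b                  ≡⟨ +-identityˡ (B b) ⟨
        0# + B b             ≡⟨ cong (_+ B b) (coords-jj (jj≢i₀ ∘ sym)) ⟨
        coords jj i₀ + B b   ≡⟨ posHull⇒cross jj ν qjj≈νq b i₀ ⟨
        coords jj b + B i₀   ≡⟨ cong₂ _+_ (coords-jj b≢jj) Bi₀≡t ⟩
        0# + t               ≡⟨ +-identityˡ t ⟩
        t                    ∎

      p-term : t * coords (punchIn jj b₀) b ≡ t * λ′ b
      p-term = trans (cong (λ a → t * coords a b) punchIn-b₀) (cong (λ c → t * c b) coords-i₀)

      t≡0 : t ≡ 0#
      t≡0 = x*y≤x⇒x≡0 (ν≥0 b₀) 1<λb
        (subst₂ _≤_ p-term Bb≡t (≤-lincomb-coords ν (punchIn jj) ν≥0 b₀ b))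

      1≡0 : 1# ≡ 0#
      1≡0 = begin
        1#                    ≡⟨ +-identityʳ 1# ⟨
        1# + 0#               ≡⟨ cong₂ _+_ (coords-diag jj) (trans Bi₀≡t t≡0) ⟨
        coords jj jj + B i₀   ≡⟨ posHull⇒cross jj ν qjj≈νq jj i₀ ⟩
        coords jj i₀ + B jj   ≡⟨ cong₂ _+_ (coords-jj (jj≢i₀ ∘ sym)) (trans Bjj≡tλjj (cong (_* λ′ jj) t≡0)) ⟩
        0# + 0# * λ′ jj       ≡⟨ +-identityˡ (0# * λ′ jj) ⟩
        0# * λ′ jj            ≡⟨ zeroˡ (λ′ jj) ⟩
        0#                    ∎

    conicalPosition : ∀ {z j₁ j₂} → λ′ z ≡ 0# → j₁ ≢ j₂ → 1# < λ′ j₁ → 1# < λ′ j₂ → ConicalPosition q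
    conicalPosition {j₁ = j₁} λz≡0 j₁≢j₂ 1<λj₁ 1<λj₂ = 0∉convHull 1<λj₁ , notInPosHull
      where
      notInPosHull : ∀ jj → ¬ InPosHull (q ∘ punchIn jj) (q jj)
      notInPosHull jj = byCases (jj ≟ i₀) (j₁ ≟ jj)
        where
        byCases : Dec (jj ≡ i₀) → Dec (j₁ ≡ jj) → ¬ InPosHull (q ∘ punchIn jj) (q jj)
        byCases (yes jj≡i₀) _           =
          subst (λ a → ¬ InPosHull (q ∘ punchIn a) (q a)) (sym jj≡i₀) (q-i₀∉posHull λz≡0)
        byCases (no  jj≢i₀) (yes j₁≡jj) =
          q-off-i₀∉posHull jj≢i₀ (λ j₂≡jj → j₁≢j₂ (trans j₁≡jj (sym j₂≡jj))) 1<λj₂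
        byCases (no  jj≢i₀) (no  j₁≢jj) = q-off-i₀∉posHull jj≢i₀ j₁≢jj 1<λj₁

at-most-one⇒all-but-one : ∀ {m p} {P : Pred (Fin (suc m)) p} → Decidable P →
                          (∀ {i j} → P i → P j → i ≡ j) → ∃ λ j → ∀ i → i ≢ j → ¬ P i
at-most-one⇒all-but-one P? unique with any? P?
... | yes (j , Pj) = j , λ i i≢j Pi → i≢j (unique Pi Pj)
... | no  ¬∃P      = zero , λ i _ Pi → ¬∃P (i , Pi)

proposition8 : (R : Reals) → let open Geometry R in
  (n : ℕ) (e : Fin (suc n) → Point n) →
  AffinelyIndependent e →
  sumᵥ e ≈ 0ᵥ →
  (m : ℕ) (x : Fin m → Point n) →
  (∀ k → ¬ (x k ≈ 0ᵥ)) →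
  (∀ i → ∃ λ k → x k ≈ e i) →
  (∀ k l → k ≢ l → ∀ c → 0# < c → ¬ (x k ≈ (c • x l))) →
  (∀ (σ : Fin (suc n) → Fin m) → Injective _≡_ _≡_ σ →
    ¬ ConicalPosition (λ i → x (σ i))) →
  ∀ k (S : Subset (suc n)) (λ′ : Fin (suc n) → ℝ) →
  IsSupport e S (x k) →
  (∀ i → i ∈ S → 0# < λ′ i) →
  (∀ i → i ∉ S → λ′ i ≡ 0#) →
  x k ≈ lincomb λ′ e →
  (∀ i → i ∈ S → 1# ≤ λ′ i) →
  (Σ (Fin (suc n)) λ i → i ∈ S × λ′ i ≡ 1#) →
  Σ (Fin (suc n)) λ j → ∀ i → i ∈ S → i ≢ j → λ′ i ≡ 1#
proposition8 R n e independent Σe≈0 m x _ vertex _ notConical k S λ′ support λ>0 λ≡0 xk≈λe 1≤λ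
             (i₀ , _ , λi₀≡1) =
  let j , notLarge = at-most-one⇒all-but-one large? large-unique in
  j , λ i i∈S i≢j → decidable-stable (λ′ i ≟ℝ 1#) (λ λi≢1 → notLarge i i≢j (i∈S , λi≢1))
  where
  open Geometry R
  open OrderedField R
  open Exchange R e independent Σe≈0 x vertex k λ′ xk≈λe (support-nonneg R λ>0 λ≡0) i₀ λi₀≡1

  outside : ∃ λ z → z ∉ S
  outside = ¬∀⟶∃¬ (suc n) (_∈ S) (_∈? S)
    (Simplex.¬full-support R e independent Σe≈0 i₀ support xk≈λe 1≤λ λi₀≡1)

  Large : Fin (suc n) → Set
  Large i = i ∈ S × λ′ i ≢ 1#

  1<large : ∀ {i} → Large i → 1# < λ′ i
  1<large {i} (i∈S , λi≢1) = ≤∧≢⇒< (1≤λ i i∈S) (λi≢1 ∘ sym)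

  large-unique : ∀ {i j} → Large i → Large j → i ≡ j
  large-unique {i} {j} large-i large-j with i ≟ j
  ... | yes i≡j = i≡j
  ... | no  i≢j = ⊥-elim (notConical σ (conical⇒injective R x σ conical) conical)
    where
    conical : ConicalPosition (λ a → x (σ a))
    conical = conicalPosition (λ≡0 _ (proj₂ outside)) i≢j (1<large large-i) (1<large large-j)

  large? : Decidable Large
  large? i = (i ∈? S) ×-dec ¬? (λ′ i ≟ℝ 1#)
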